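{- For any integer $n\ge 2$ and any $1\le k\le n$, $|AW_{n,k}|=|BW_{n,n+1-k}|$.
   Context: For a permutation $\pi=p_1p_2\ldots p_n$ of $[n]$ (one-line notation), an index $i$ is a weak excedance if $p_i\ge i$; $W_{n,m}$ is the set of permutations of $[n]$ with exactly $m$ weak excedances. $AW_{n,m}=\{\pi=p_1\ldots p_n\in W_{n,m} : p_1<p_n\}$ and $BW_{n,m}=W_{n,m}\setminus AW_{n,m}$ (those with $p_1>p_n$). -}

module Defs where

open import Data.Bool using (Bool; true; false; _∧_; not; T)
open import Data.Nat using (ℕ; suc; _<ᵇ_; _≤?_; _≡ᵇ_)
open import Data.Fin using (Fin; toℕ; _≟_)
open import Data.List using (List; length; filter; map)
open import Data.Bool.ListAction using (and)
open import Data.Vec using (Vec; []; _∷_; lookup; last)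
open import Data.List using (allFin)
open import Data.Product using (Σ)
open import Relation.Nullary.Decidable using (⌊_⌋)

-- A permutation of [n] in one-line notation is a word v = p₁…pₙ, stored as
-- Vec (Fin n) n (values/indices shifted to 0-based), whose entries are pairwise
-- distinct.  Pairwise distinctness is a Bool, so the subtype below is a proper
-- (proof-irrelevant) subset of the finite type Vec (Fin n) n.
allL : ∀ {A : Set} → (A → Bool) → List A → Bool
allL p xs = and (map p xs)

isPerm : ∀ {n} → Vec (Fin n) n → Bool
isPerm {n} v =
  allL (λ i → allL (λ j → ⌊ i ≟ j ⌋ Data.Bool.∨ not ⌊ lookup v i ≟ lookup v j ⌋) (allFin n)) (allFin n)

-- number of weak excedances: indices i with p_i ≥ i
-- (1-based p_i ≥ i  ⇔  0-based toℕ (lookup v i) ≥ toℕ i)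
wex : ∀ {n} → Vec (Fin n) n → ℕ
wex {n} v = length (filter (λ i → toℕ i ≤? toℕ (lookup v i)) (allFin n))

firstLtLast : ∀ {n} → Vec (Fin n) n → Bool
firstLtLast [] = false
firstLtLast (x ∷ xs) = toℕ x <ᵇ toℕ (last (x ∷ xs))

inW : (n m : ℕ) → Vec (Fin n) n → Bool
inW n m v = isPerm v ∧ (wex v ≡ᵇ m)

AW : (n m : ℕ) → Set
AW n m = Σ (Vec (Fin n) n) (λ v → T (inW n m v ∧ firstLtLast v))

BW : (n m : ℕ) → Set
BW n m = Σ (Vec (Fin n) n) (λ v → T (inW n m v ∧ not (firstLtLast v)))

module Submission where

open import Defs
open import Data.Nat using (ℕ; _≤_; _+_; _∸_)
open import Function.Bundles using (_↔_)

open import Data.Bool using (Bool; true; false; T; _∧_; _∨_; not)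
open import Data.Bool.Properties using (T-∧; T-irrelevant)
open import Data.Nat as ℕ using (zero; suc; _<_; s≤s; z≤n; _≤?_; _<ᵇ_)
open import Data.Nat.Properties
  using (+-0-commutativeMonoid; +-cancelʳ-≡; ≤-trans; m≤m+n; 1+n≰n; ≤∧≢⇒<; ≤⇒≯; <⇒≱; ≰⇒>; ≮⇒≥;
         <-asym; ∸-monoʳ-<; ∸-monoʳ-≤; m+n∸n≡m; m∸[m∸n]≡n; <ᵇ⇒<; <⇒<ᵇ; ≡ᵇ⇒≡; ≡⇒≡ᵇ)
open import Data.Fin
  using (Fin; zero; suc; toℕ; fromℕ; inject₁; lower₁; opposite; punchIn; punchOut; _≟_)
open import Data.Fin.Properties
  using (toℕ-injective; toℕ-fromℕ; toℕ-inject₁; toℕ-inject₁-≢; lower₁-inject₁′; fromℕ≢inject₁;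
         ≤fromℕ; toℕ<n; opposite-prop; opposite-involutive; punchInᵢ≢i; punchOut-injective;
         injective⇒≤; any?)
open import Data.Fin.Permutation using (permutation)
open import Data.List as List using (length; filter; allFin)
open import Data.List.Relation.Unary.All.Properties using (all⁺; all⁻; tabulate⁺; tabulate⁻)
open import Data.Vec using (Vec; _∷_; []; lookup; tabulate; last)
open import Data.Vec.Properties using (lookup∘tabulate; tabulate∘lookup; tabulate-cong)
open import Data.Vec.Functional using (removeAt)
open import Data.Product using (Σ; ∃; _,_; _×_; proj₁; proj₂)
open import Data.Product.Properties using (Σ-≡,≡→≡)
open import Data.Unit using (tt)
open import Function using (_∘_; id; _⇔_; mk⇔; Equivalence; case_of_)
open import Function.Bundles using (mk↔ₛ′)
open import Function.Construct.Composition using (_⇔-∘_)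
open import Function.Related.TypeIsomorphisms using (¬-cong-⇔)
open import Data.Product.Function.NonDependent.Propositional using (_×-⇔_)
open import Function.Definitions using (Injective)
open import Relation.Nullary using (Dec; yes; no; ¬_; contradiction)
open import Relation.Nullary.Decidable using (⌊_⌋)
open import Relation.Unary using (Pred; Decidable)
open import Relation.Binary.PropositionalEquality
open ≡-Reasoning
open import Algebra.Properties.CommutativeMonoid.Sum +-0-commutativeMonoid
  using (sum; sum-cong-≗; sum-remove; sum-replicate-zero; ∑-distrib-+; sum-permute)

-- Write n = m + 2 and work 0-based, so the largest value "top" (the letter n)
-- and the last position are both m + 1.  Let ν be the involution of the values that fixes
-- top and reverses 0 … m, and for an involution s of the positions let reflect s v be the
-- word i ↦ ν (v (s i)).  For the full reversal s i = m+1-i, position i is a weak excedance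
-- of v exactly when s i is not one of reflect s v, except that the position carrying top
-- counts for both (lemma exchange); summing over all positions gives
--   wex (reflect s v) + wex v = n + 1.
-- The same total holds for the reversal ρ of the interior positions only, provided
-- neither end letter of v is top.  The bijection AW n k → BW n (n+1-k) reflects through the
-- full reversal if the last letter is top and through ρ otherwise; its inverse makes the
-- same choice by looking at the first letter.  Both maps preserve permutations, exchange
-- ascents p₁ < pₙ and descents p₁ > pₙ, and undo each other as the reflections are
-- involutions.
-- Order of the file: counting with indicators; the value involution ν; the exchange lemma;
-- positions and ρ; reading the Boolean definitions of Defs; the weak-excedance complement
-- formulas; the bijection; membership in AW and BW and the theorem.

private
  variable
    n m : ℕ
    A : Set

Involution : (A → A) → Set
Involution s = ∀ x → s (s x) ≡ x

-- Counting with indicators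

𝟙 : ∀ {P : Set} → Dec P → ℕ
𝟙 (yes _) = 1
𝟙 (no _)  = 0

𝟙-yes : ∀ {P : Set} (P? : Dec P) → P → 𝟙 P? ≡ 1
𝟙-yes (yes _) _ = refl
𝟙-yes (no ¬p) p = contradiction p ¬p

𝟙-no : ∀ {P : Set} (P? : Dec P) → ¬ P → 𝟙 P? ≡ 0
𝟙-no (yes p) ¬p = contradiction p ¬p
𝟙-no (no _)  _  = refl

𝟙-complement : ∀ {P Q : Set} (P? : Dec P) (Q? : Dec Q) → (P → ¬ Q) → (¬ Q → P) → 𝟙 P? + 𝟙 Q? ≡ 1
𝟙-complement P? (yes q) p⇒¬q _    = cong (_+ 1) (𝟙-no P? (λ p → p⇒¬q p q))
𝟙-complement P? (no ¬q) _    ¬q⇒p = cong (_+ 0) (𝟙-yes P? (¬q⇒p ¬q))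

length-filter-tabulate : ∀ {P : Pred A _} (P? : Decidable P) (g : Fin n → A) →
                         length (filter P? (List.tabulate g)) ≡ sum (λ i → 𝟙 (P? (g i)))
length-filter-tabulate {n = zero}  P? g = refl
length-filter-tabulate {n = suc n} P? g with P? (g zero)
... | yes _ = cong suc (length-filter-tabulate P? (g ∘ suc))
... | no _  = length-filter-tabulate P? (g ∘ suc)

-- Pigeonhole: an injective self-map of Fin n is onto.  If c were missed, removing c from
-- the codomain would inject Fin (suc n) into Fin n.
injective⇒surjective : ∀ (f : Fin n → Fin n) → Injective _≡_ _≡_ f → ∀ c → ∃ λ i → f i ≡ c
injective⇒surjective {suc n} f f-inj c with any? (λ i → f i ≟ c)
... | yes hit = hit
... | no miss = contradiction (injective⇒≤ {f = squeeze} squeeze-inj) 1+n≰n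
  where
  c≢f : ∀ i → c ≢ f i
  c≢f i c≡fi = miss (i , sym c≡fi)
  squeeze : Fin (suc n) → Fin n
  squeeze i = punchOut (c≢f i)
  squeeze-inj : Injective _≡_ _≡_ squeeze
  squeeze-inj eq = f-inj (punchOut-injective (c≢f _) (c≢f _) eq)

sum-point : ∀ (t : Fin (suc n) → ℕ) j → t j ≡ 1 → (∀ i → i ≢ j → t i ≡ 0) → sum t ≡ 1
sum-point {n} t j tj≡1 vanish = begin
  sum t                     ≡⟨ sum-remove {i = j} t ⟩
  t j + sum (removeAt t j)  ≡⟨ cong₂ _+_ tj≡1 (sum-cong-≗ λ k → vanish (punchIn j k) (punchInᵢ≢i j k)) ⟩
  1 + sum {n} (λ _ → 0)     ≡⟨ cong suc (sum-replicate-zero n) ⟩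
  1                         ∎

fibre-count : ∀ (f : Fin n → Fin n) → Injective _≡_ _≡_ f → ∀ c → sum (λ i → 𝟙 (f i ≟ c)) ≡ 1
fibre-count {suc n} f f-inj c with injective⇒surjective f f-inj c
... | j , fj≡c = sum-point (λ i → 𝟙 (f i ≟ c)) j (𝟙-yes (f j ≟ c) fj≡c)
                   (λ i i≢j → 𝟙-no (f i ≟ c) (λ fi≡c → i≢j (f-inj (trans fi≡c (sym fj≡c)))))

sum-ones : ∀ n → sum {n} (λ _ → 1) ≡ n
sum-ones zero    = refl
sum-ones (suc n) = cong suc (sum-ones n)

sum-balance : ∀ (a b c d e : Fin n → ℕ) → (∀ i → a i + b i + c i ≡ 1 + d i + e i) →
              sum c ≡ sum e → sum d ≡ 1 → sum a + sum b ≡ n + 1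
sum-balance {n} a b c d e pointwise Σc≡Σe Σd≡1 = +-cancelʳ-≡ (sum c) _ _ (begin
  sum a + sum b + sum c             ≡⟨ cong (_+ sum c) (∑-distrib-+ a b) ⟨
  sum (λ i → a i + b i) + sum c     ≡⟨ ∑-distrib-+ (λ i → a i + b i) c ⟨
  sum (λ i → a i + b i + c i)       ≡⟨ sum-cong-≗ pointwise ⟩
  sum (λ i → 1 + d i + e i)         ≡⟨ ∑-distrib-+ (λ i → 1 + d i) e ⟩
  sum (λ i → 1 + d i) + sum e       ≡⟨ cong (_+ sum e) (∑-distrib-+ {n} (λ _ → 1) d) ⟩
  sum {n} (λ _ → 1) + sum d + sum e ≡⟨ cong₂ (λ x y → x + y + sum e) (sum-ones n) Σd≡1 ⟩
  n + 1 + sum e                     ≡⟨ cong (n + 1 +_) Σc≡Σe ⟨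
  n + 1 + sum c                     ∎)

sum-reindex : ∀ (s : Fin n → Fin n) → Involution s → (t : Fin n → ℕ) → sum t ≡ sum (t ∘ s)
sum-reindex s s-inv t = sum-permute t (permutation s s s-inv s-inv)

-- The top value and the value involution ν

-- The largest element of Fin (suc n): the value n (1-based) and also the last position.
top : Fin (suc n)
top {n} = fromℕ n

data TopOrBelow {n : ℕ} : Fin (suc n) → Set where
  isTop : TopOrBelow top
  below : (y : Fin n) → TopOrBelow (inject₁ y)

topOrBelow : ∀ (x : Fin (suc n)) → TopOrBelow x
topOrBelow {zero}  zero    = isTop
topOrBelow {suc n} zero    = below zero
topOrBelow {suc n} (suc x) with topOrBelow x
... | isTop   = isTop
... | below y = below (suc y)

≢top⇒<top : ∀ {x : Fin (suc n)} → x ≢ top → toℕ x < toℕ (top {n})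
≢top⇒<top {x = x} x≢top = ≤∧≢⇒< (≤fromℕ x) (x≢top ∘ toℕ-injective)

<⇒≢top : ∀ {x y : Fin (suc n)} → toℕ x < toℕ y → x ≢ top
<⇒≢top {y = y} x<y refl = ≤⇒≯ (≤fromℕ y) x<y

ν : Fin (suc n) → Fin (suc n)
ν {n} x with n ℕ.≟ toℕ x
... | yes _   = x
... | no n≢x = inject₁ (opposite (lower₁ x n≢x))

ν-top : ν (top {n}) ≡ top
ν-top {n} with n ℕ.≟ toℕ (fromℕ n)
... | yes _     = refl
... | no n≢top = contradiction (sym (toℕ-fromℕ n)) n≢top

ν-below : ∀ (y : Fin n) → ν (inject₁ y) ≡ inject₁ (opposite y)
ν-below {n} y with n ℕ.≟ toℕ (inject₁ y)
... | yes n≡y = contradiction n≡y (toℕ-inject₁-≢ y)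
... | no n≢y  = cong (inject₁ ∘ opposite) (lower₁-inject₁′ y n≢y)

toℕ-ν-below : ∀ (y : Fin n) → toℕ (ν (inject₁ y)) ≡ n ∸ suc (toℕ y)
toℕ-ν-below y = trans (cong toℕ (ν-below y)) (trans (toℕ-inject₁ (opposite y)) (opposite-prop y))

ν-involutive : Involution (ν {n})
ν-involutive x with topOrBelow x
... | isTop   = trans (cong ν ν-top) ν-top
... | below y = begin
  ν (ν (inject₁ y))                ≡⟨ cong ν (ν-below y) ⟩
  ν (inject₁ (opposite y))         ≡⟨ ν-below (opposite y) ⟩
  inject₁ (opposite (opposite y))  ≡⟨ cong inject₁ (opposite-involutive y) ⟩
  inject₁ y                        ∎

ν-injective : Injective _≡_ _≡_ (ν {n})
ν-injective {x = x} {y = y} νx≡νy = begin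
  x         ≡⟨ ν-involutive x ⟨
  ν (ν x)   ≡⟨ cong ν νx≡νy ⟩
  ν (ν y)   ≡⟨ ν-involutive y ⟩
  y         ∎

ν-≢top : ∀ {x : Fin (suc n)} → x ≢ top → ν x ≢ top
ν-≢top x≢top νx≡top = x≢top (ν-injective (trans νx≡top (sym ν-top)))

ν-antitone : ∀ {x y : Fin (suc n)} → toℕ x < toℕ y → y ≢ top → toℕ (ν y) < toℕ (ν x)
ν-antitone {x = x} {y} x<y y≢top with topOrBelow x | topOrBelow y
... | isTop   | _       = contradiction refl (<⇒≢top x<y)
... | below _ | isTop   = contradiction refl y≢top
... | below a | below b = subst₂ _<_ (sym (toℕ-ν-below b)) (sym (toℕ-ν-below a))
                            (∸-monoʳ-< (s≤s a<b) (toℕ<n b))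
  where
  a<b : toℕ a < toℕ b
  a<b = subst₂ _<_ (toℕ-inject₁ a) (toℕ-inject₁ b) x<y

-- The exchange lemma

∸-mirror : ∀ {n a b} → b < n → (n ∸ a ≤ n ∸ suc b → ¬ a ≤ b) × (¬ a ≤ b → n ∸ a ≤ n ∸ suc b)
∸-mirror {n} b<n = (λ le a≤b → ≤⇒≯ le (∸-monoʳ-< (s≤s a≤b) b<n))
                 , (λ a≰b → ∸-monoʳ-≤ n (≰⇒> a≰b))

exchange : ∀ (i x : Fin (suc n)) →
           𝟙 (toℕ (opposite i) ≤? toℕ (ν x)) + 𝟙 (toℕ i ≤? toℕ x) ≡ 1 + 𝟙 (x ≟ top)
exchange {n} i x with topOrBelow x
... | isTop
  rewrite ν-top {n} | 𝟙-yes (toℕ (opposite i) ≤? toℕ (top {n})) (≤fromℕ (opposite i))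
        | 𝟙-yes (toℕ i ≤? toℕ (top {n})) (≤fromℕ i) | 𝟙-yes (top {n} ≟ top) refl
  = refl
... | below y
  rewrite toℕ-ν-below y | opposite-prop i | toℕ-inject₁ y
        | 𝟙-no (inject₁ y ≟ top) (fromℕ≢inject₁ ∘ sym)
  = 𝟙-complement (n ∸ toℕ i ≤? n ∸ suc (toℕ y)) (toℕ i ≤? toℕ y)
                 (proj₁ (∸-mirror (toℕ<n y))) (proj₂ (∸-mirror (toℕ<n y)))

-- Positions of a word of length m + 2 and the interior reversal ρ

data Position {m : ℕ} : Fin (suc (suc m)) → Set where
  first    : Position zero
  final    : Position top
  interior : (y : Fin m) → Position (suc (inject₁ y))

position : ∀ (i : Fin (suc (suc m))) → Position i
position zero = first
position (suc j) with topOrBelow j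
... | isTop   = final
... | below y = interior y

-- ρ fixes the first and the last position and reverses the interior ones.
ρ : Fin (suc (suc m)) → Fin (suc (suc m))
ρ zero    = zero
ρ (suc j) = suc (ν j)

ρ-involutive : Involution (ρ {m})
ρ-involutive zero    = refl
ρ-involutive (suc j) = cong suc (ν-involutive j)

ρ-final : ρ (top {suc m}) ≡ top
ρ-final = cong suc ν-top

opposite-inject₁ : ∀ (y : Fin n) → opposite (inject₁ y) ≡ suc (opposite y)
opposite-inject₁ zero    = refl
opposite-inject₁ (suc y) = cong inject₁ (opposite-inject₁ y)

ρ-interior : ∀ (y : Fin m) → ρ (suc (inject₁ y)) ≡ opposite (suc (inject₁ y))
ρ-interior y = trans (cong suc (ν-below y)) (sym (cong inject₁ (opposite-inject₁ y)))

opposite-top : opposite (top {n}) ≡ zero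
opposite-top = opposite-involutive zero

Word : ℕ → Set
Word n = Vec (Fin n) n

IsPermutation : Word n → Set
IsPermutation v = Injective _≡_ _≡_ (lookup v)

all-allFin⇔ : ∀ (p : Fin n → Bool) → T (allL p (allFin n)) ⇔ (∀ i → T (p i))
all-allFin⇔ p = mk⇔ (λ h → tabulate⁻ (all⁺ p _ h)) (λ h → all⁻ p (tabulate⁺ h))

distinct-pair⇔ : ∀ (v : Word n) i j →
  T (⌊ i ≟ j ⌋ ∨ not ⌊ lookup v i ≟ lookup v j ⌋) ⇔ (lookup v i ≡ lookup v j → i ≡ j)
distinct-pair⇔ v i j with i ≟ j | lookup v i ≟ lookup v j
... | yes i≡j | _           = mk⇔ (λ _ _ → i≡j) (λ _ → tt)
... | no i≢j  | yes vi≡vj   = mk⇔ (λ ()) (λ h → i≢j (h vi≡vj))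
... | no _    | no vi≢vj    = mk⇔ (λ _ vi≡vj → contradiction vi≡vj vi≢vj) (λ _ → tt)

isPerm⇔ : ∀ (v : Word n) → T (isPerm v) ⇔ IsPermutation v
isPerm⇔ v = mk⇔
  (λ h {i} {j} → Equivalence.to (distinct-pair⇔ v i j)
                   (Equivalence.to (all-allFin⇔ _) (Equivalence.to (all-allFin⇔ _) h i) j))
  (λ inj → Equivalence.from (all-allFin⇔ _) λ i → Equivalence.from (all-allFin⇔ _) λ j →
             Equivalence.from (distinct-pair⇔ v i j) inj)

weak : (Fin n → Fin n) → Fin n → ℕ
weak f i = 𝟙 (toℕ i ≤? toℕ (f i))

wex≡sum : ∀ (v : Word n) → wex v ≡ sum (weak (lookup v))
wex≡sum v = length-filter-tabulate (λ i → toℕ i ≤? toℕ (lookup v i)) id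

last≡lookup : ∀ (v : Vec A (suc n)) → last v ≡ lookup v top
last≡lookup {n = zero}  (x ∷ []) = refl
last≡lookup {n = suc n} (x ∷ xs) = last≡lookup xs

Ascent : Word (suc n) → Set
Ascent v = toℕ (lookup v zero) < toℕ (lookup v top)

firstLtLast⇔ : ∀ (v : Word (suc n)) → T (firstLtLast v) ⇔ Ascent v
firstLtLast⇔ v@(x ∷ _) = mk⇔ (λ h → <ᵇ⇒< _ _ (subst T lt≡ h)) (λ lt → subst T (sym lt≡) (<⇒<ᵇ lt))
  where
  lt≡ : firstLtLast v ≡ (toℕ x <ᵇ toℕ (lookup v top))
  lt≡ = cong (λ z → toℕ x <ᵇ toℕ z) (last≡lookup v)

inW⇔ : ∀ k (v : Word n) → T (inW n k v) ⇔ (IsPermutation v × wex v ≡ k)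
inW⇔ {n} k v = mk⇔ read write
  where
  read : T (inW n k v) → IsPermutation v × wex v ≡ k
  read h with p , w ← Equivalence.to T-∧ h = Equivalence.to (isPerm⇔ v) p , ≡ᵇ⇒≡ _ _ w
  write : IsPermutation v × wex v ≡ k → T (inW n k v)
  write (p , w) = Equivalence.from T-∧ (Equivalence.from (isPerm⇔ v) p , ≡⇒≡ᵇ _ _ w)

-- Reflected words and the weak-excedance complement formulas

reflect : (Fin (suc n) → Fin (suc n)) → Word (suc n) → Word (suc n)
reflect s v = tabulate (λ i → ν (lookup v (s i)))

lookup-reflect : ∀ s (v : Word (suc n)) i → lookup (reflect s v) i ≡ ν (lookup v (s i))
lookup-reflect s v = lookup∘tabulate (λ i → ν (lookup v (s i)))

reflect-involutive : ∀ (s : Fin (suc n) → Fin (suc n)) → Involution s → Involution (reflect s)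
reflect-involutive s s-inv v = trans (tabulate-cong twice) (tabulate∘lookup v)
  where
  twice : ∀ i → ν (lookup (reflect s v) (s i)) ≡ lookup v i
  twice i = begin
    ν (lookup (reflect s v) (s i))   ≡⟨ cong ν (lookup-reflect s v (s i)) ⟩
    ν (ν (lookup v (s (s i))))       ≡⟨ ν-involutive _ ⟩
    lookup v (s (s i))               ≡⟨ cong (lookup v) (s-inv i) ⟩
    lookup v i                       ∎

reflect-permutation : ∀ (s : Fin (suc n) → Fin (suc n)) → Involution s →
                      ∀ {v} → IsPermutation v → IsPermutation (reflect s v)
reflect-permutation s s-inv {v} v-inj {i} {j} eq = begin
  i          ≡⟨ s-inv i ⟨
  s (s i)    ≡⟨ cong s (v-inj (ν-injective same-letter)) ⟩
  s (s j)    ≡⟨ s-inv j ⟩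
  j          ∎
  where
  same-letter : ν (lookup v (s i)) ≡ ν (lookup v (s j))
  same-letter = trans (sym (lookup-reflect s v i)) (trans eq (lookup-reflect s v j))

reflected-weak : (Fin (suc n) → Fin (suc n)) → (Fin (suc n) → Fin (suc n)) → Fin (suc n) → ℕ
reflected-weak s f i = 𝟙 (toℕ (s i) ≤? toℕ (ν (f i)))

wex-reflect : ∀ (s : Fin (suc n) → Fin (suc n)) → Involution s → ∀ v →
              wex (reflect s v) ≡ sum (reflected-weak s (lookup v))
wex-reflect {n} s s-inv v = begin
  wex (reflect s v)                 ≡⟨ wex≡sum (reflect s v) ⟩
  sum (weak (lookup (reflect s v))) ≡⟨ sum-cong-≗ (λ i → cong (g i) (lookup-reflect s v i)) ⟩
  sum (λ i → g i (ν (lookup v (s i))))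
    ≡⟨ sum-reindex s s-inv (λ i → g i (ν (lookup v (s i)))) ⟩
  sum (λ i → g (s i) (ν (lookup v (s (s i)))))
    ≡⟨ sum-cong-≗ (λ i → cong (g (s i) ∘ ν ∘ lookup v) (s-inv i)) ⟩
  sum (λ i → g (s i) (ν (lookup v i)))            ∎
  where
  g : Fin (suc n) → Fin (suc n) → ℕ
  g i x = 𝟙 (toℕ i ≤? toℕ x)

wex-reflect-opposite : ∀ (v : Word (suc n)) → IsPermutation v →
                       wex (reflect opposite v) + wex v ≡ suc n + 1
wex-reflect-opposite {n} v v-inj = begin
  wex (reflect opposite v) + wex v
    ≡⟨ cong₂ _+_ (wex-reflect opposite opposite-involutive v) (wex≡sum v) ⟩
  sum (reflected-weak opposite (lookup v)) + sum (weak (lookup v))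
    ≡⟨ sum-balance (reflected-weak opposite (lookup v)) (weak (lookup v))
         (λ _ → 0) (λ i → 𝟙 (lookup v i ≟ top)) (λ _ → 0)
         (λ i → cong (_+ 0) (exchange i (lookup v i))) refl (fibre-count (lookup v) v-inj top) ⟩
  suc n + 1 ∎

-- The exchange lemma for ρ: at the first position both words have a weak excedance, at
-- the last position neither has, and the interior behaves as for the full reversal.
ρ-exchange : ∀ (f : Fin (suc (suc m)) → Fin (suc (suc m))) → f zero ≢ top → f top ≢ top → ∀ i →
             reflected-weak ρ f i + weak f i + 𝟙 (i ≟ top) ≡ 1 + 𝟙 (f i ≟ top) + 𝟙 (i ≟ zero)
ρ-exchange f f₀≢top _ i with position i
... | first
  rewrite 𝟙-no (f zero ≟ top) f₀≢top = refl
ρ-exchange {m} f _ fₙ≢top i | final = begin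
  reflected-weak ρ f ℓ + weak f ℓ + 𝟙 (ℓ ≟ ℓ)
    ≡⟨ cong₂ (λ a b → a + b + 𝟙 (ℓ ≟ ℓ)) reflected-not-weak last-not-weak ⟩
  𝟙 (ℓ ≟ ℓ)                     ≡⟨ 𝟙-yes (ℓ ≟ ℓ) refl ⟩
  1                             ≡⟨ cong (λ d → 1 + d + 0) (𝟙-no (f ℓ ≟ ℓ) fₙ≢top) ⟨
  1 + 𝟙 (f ℓ ≟ ℓ) + 𝟙 (ℓ ≟ zero) ∎
  where
  ℓ : Fin (suc (suc m))
  ℓ = top
  below-last : ∀ {x} → x ≢ top → ¬ toℕ ℓ ≤ toℕ x
  below-last x≢top = <⇒≱ (≢top⇒<top x≢top)
  reflected-not-weak : reflected-weak ρ f ℓ ≡ 0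
  reflected-not-weak =
    𝟙-no _ (below-last (ν-≢top fₙ≢top) ∘ subst (_≤ toℕ (ν (f ℓ))) (cong toℕ (ρ-final {m})))
  last-not-weak : weak f ℓ ≡ 0
  last-not-weak = 𝟙-no _ (below-last fₙ≢top)
ρ-exchange {m} f _ _ i | interior y = begin
  reflected-weak ρ f j + weak f j + 𝟙 (j ≟ top)
    ≡⟨ cong₂ (λ p c → 𝟙 (toℕ p ≤? toℕ (ν (f j))) + weak f j + c)
             (ρ-interior y) (𝟙-no (j ≟ top) (fromℕ≢inject₁ ∘ sym)) ⟩
  reflected-weak opposite f j + weak f j + 0
    ≡⟨ cong (_+ 0) (exchange j (f j)) ⟩
  1 + 𝟙 (f j ≟ top) + 0 ∎
  where
  j : Fin (suc (suc m))
  j = suc (inject₁ y)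

wex-reflect-ρ : ∀ (v : Word (suc (suc m))) → IsPermutation v →
                lookup v zero ≢ top → lookup v top ≢ top →
                wex (reflect ρ v) + wex v ≡ suc (suc m) + 1
wex-reflect-ρ {m} v v-inj v₀≢top vₙ≢top = begin
  wex (reflect ρ v) + wex v
    ≡⟨ cong₂ _+_ (wex-reflect ρ ρ-involutive v) (wex≡sum v) ⟩
  sum (reflected-weak ρ (lookup v)) + sum (weak (lookup v))
    ≡⟨ sum-balance (reflected-weak ρ (lookup v)) (weak (lookup v))
         (λ i → 𝟙 (i ≟ top)) (λ i → 𝟙 (lookup v i ≟ top)) (λ i → 𝟙 (i ≟ zero))
         (ρ-exchange (lookup v) v₀≢top vₙ≢top)
         (trans (fibre-count {suc (suc m)} id id top) (sym (fibre-count {suc (suc m)} id id zero)))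
         (fibre-count (lookup v) v-inj top) ⟩
  suc (suc m) + 1 ∎

-- The bijection

transform : ∀ {P : Set} → Dec P → Word (suc (suc m)) → Word (suc (suc m))
transform (yes _) = reflect opposite
transform (no _)  = reflect ρ

transform-yes : ∀ {P : Set} (P? : Dec P) → P →
                ∀ (v : Word (suc (suc m))) → transform P? v ≡ reflect opposite v
transform-yes (yes _) _ v = refl
transform-yes (no ¬p) p v = contradiction p ¬p

transform-no : ∀ {P : Set} (P? : Dec P) → ¬ P →
               ∀ (v : Word (suc (suc m))) → transform P? v ≡ reflect ρ v
transform-no (yes p) ¬p v = contradiction p ¬p
transform-no (no _)  _  v = refl

transform-permutation : ∀ {P : Set} (P? : Dec P) (v : Word (suc (suc m))) →
                        IsPermutation v → IsPermutation (transform P? v)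
transform-permutation (yes _) v = reflect-permutation opposite opposite-involutive {v}
transform-permutation (no _)  v = reflect-permutation ρ ρ-involutive {v}

Φ : Word (suc (suc m)) → Word (suc (suc m))
Φ v = transform (lookup v top ≟ top) v

Ψ : Word (suc (suc m)) → Word (suc (suc m))
Ψ w = transform (lookup w zero ≟ top) w

first-opposite : ∀ (v : Word (suc n)) → lookup (reflect opposite v) zero ≡ ν (lookup v top)
first-opposite v = lookup-reflect opposite v zero

last-opposite : ∀ (v : Word (suc n)) → lookup (reflect opposite v) top ≡ ν (lookup v zero)
last-opposite v = trans (lookup-reflect opposite v top) (cong (ν ∘ lookup v) opposite-top)

first-ρ : ∀ (v : Word (suc (suc m))) → lookup (reflect ρ v) zero ≡ ν (lookup v zero)
first-ρ v = lookup-reflect ρ v zero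

last-ρ : ∀ (v : Word (suc (suc m))) → lookup (reflect ρ v) top ≡ ν (lookup v top)
last-ρ v = trans (lookup-reflect ρ v top) (cong (ν ∘ lookup v) ρ-final)

Descent : Word (suc n) → Set
Descent v = toℕ (lookup v top) < toℕ (lookup v zero)

-- In a permutation of length ≥ 2 the first and last letters differ.
descent-of-non-ascent : ∀ (w : Word (suc (suc m))) → IsPermutation w → ¬ Ascent w → Descent w
descent-of-non-ascent w w-inj ¬asc =
  ≤∧≢⇒< (≮⇒≥ ¬asc) (λ eq → case w-inj (toℕ-injective eq) of λ ())

-- Φ turns an ascent into a non-ascent: if the last letter is the top, Φ v starts with
-- the top; otherwise the end letters are both reflected by the order-reversing ν.
Φ-descent : ∀ (v : Word (suc (suc m))) → Ascent v → ¬ Ascent (Φ v)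
Φ-descent v asc = for (lookup v top ≟ top)
  where
  for : (P? : Dec (lookup v top ≡ top)) → ¬ Ascent (transform P? v)
  for (yes vₙ≡top) asc′ = <⇒≢top asc′ (trans (first-opposite v) (trans (cong ν vₙ≡top) ν-top))
  for (no vₙ≢top)  asc′ = <-asym asc′ (subst₂ _<_ (cong toℕ (sym (last-ρ v)))
                                                   (cong toℕ (sym (first-ρ v)))
                                                   (ν-antitone asc vₙ≢top))

Ψ-ascent : ∀ (w : Word (suc (suc m))) → Descent w → Ascent (Ψ w)
Ψ-ascent w desc = for (lookup w zero ≟ top)
  where
  for : (P? : Dec (lookup w zero ≡ top)) → Ascent (transform P? w)
  for (yes w₀≡top) = subst₂ _<_ (cong toℕ (sym (first-opposite w)))
                       (cong toℕ (sym (trans (last-opposite w) (trans (cong ν w₀≡top) ν-top))))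
                       (≢top⇒<top (ν-≢top (<⇒≢top desc)))
  for (no w₀≢top)  = subst₂ _<_ (cong toℕ (sym (first-ρ w))) (cong toℕ (sym (last-ρ w)))
                       (ν-antitone desc w₀≢top)

-- Φ and Ψ complement the number of weak excedances with respect to n + 1; the case
-- of ρ applies since in it neither end letter is the top.
Φ-wex : ∀ (v : Word (suc (suc m))) → IsPermutation v → Ascent v →
        wex (Φ v) + wex v ≡ suc (suc m) + 1
Φ-wex v v-inj asc = for (lookup v top ≟ top)
  where
  for : (P? : Dec (lookup v top ≡ top)) → wex (transform P? v) + wex v ≡ _
  for (yes _)      = wex-reflect-opposite v v-inj
  for (no vₙ≢top) = wex-reflect-ρ v v-inj (<⇒≢top asc) vₙ≢top

Ψ-wex : ∀ (w : Word (suc (suc m))) → IsPermutation w → Descent w →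
        wex (Ψ w) + wex w ≡ suc (suc m) + 1
Ψ-wex w w-inj desc = for (lookup w zero ≟ top)
  where
  for : (P? : Dec (lookup w zero ≡ top)) → wex (transform P? w) + wex w ≡ _
  for (yes _)      = wex-reflect-opposite w w-inj
  for (no w₀≢top) = wex-reflect-ρ w w-inj w₀≢top (<⇒≢top desc)

-- Ψ makes for Φ v the same choice Φ made for v, so it undoes Φ.
Ψ∘Φ : ∀ (v : Word (suc (suc m))) → Ascent v → Ψ (Φ v) ≡ v
Ψ∘Φ v asc = for (lookup v top ≟ top)
  where
  for : (P? : Dec (lookup v top ≡ top)) → Ψ (transform P? v) ≡ v
  for (yes vₙ≡top) =
    trans (transform-yes (lookup (reflect opposite v) zero ≟ top)
                         (trans (first-opposite v) (trans (cong ν vₙ≡top) ν-top)) (reflect opposite v))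
          (reflect-involutive opposite opposite-involutive v)
  for (no _) =
    trans (transform-no (lookup (reflect ρ v) zero ≟ top)
                        (ν-≢top (<⇒≢top asc) ∘ trans (sym (first-ρ v))) (reflect ρ v))
          (reflect-involutive ρ ρ-involutive v)

Φ∘Ψ : ∀ (w : Word (suc (suc m))) → Descent w → Φ (Ψ w) ≡ w
Φ∘Ψ w desc = for (lookup w zero ≟ top)
  where
  for : (P? : Dec (lookup w zero ≡ top)) → Φ (transform P? w) ≡ w
  for (yes w₀≡top) =
    trans (transform-yes (lookup (reflect opposite w) top ≟ top)
                         (trans (last-opposite w) (trans (cong ν w₀≡top) ν-top)) (reflect opposite w))
          (reflect-involutive opposite opposite-involutive w)
  for (no _) =
    trans (transform-no (lookup (reflect ρ w) top ≟ top)
                        (ν-≢top (<⇒≢top desc) ∘ trans (sym (last-ρ w))) (reflect ρ w))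
          (reflect-involutive ρ ρ-involutive w)

T-not⇔¬T : ∀ b → T (not b) ⇔ (¬ T b)
T-not⇔¬T true  = mk⇔ (λ ()) (λ ¬t → ¬t tt)
T-not⇔¬T false = mk⇔ (λ _ ()) (λ _ → tt)

AW-member : ∀ k (v : Word (suc n)) →
            T (inW (suc n) k v ∧ firstLtLast v) ⇔ ((IsPermutation v × wex v ≡ k) × Ascent v)
AW-member k v = (inW⇔ k v ×-⇔ firstLtLast⇔ v) ⇔-∘ T-∧

BW-member : ∀ k (v : Word (suc n)) →
            T (inW (suc n) k v ∧ not (firstLtLast v)) ⇔ ((IsPermutation v × wex v ≡ k) × ¬ Ascent v)
BW-member k v = (inW⇔ k v ×-⇔ (¬-cong-⇔ (firstLtLast⇔ v) ⇔-∘ T-not⇔¬T (firstLtLast v))) ⇔-∘ T-∧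

AW-ascent : ∀ k (v : Word (suc n)) → T (inW (suc n) k v ∧ firstLtLast v) → Ascent v
AW-ascent k v mem = proj₂ (Equivalence.to (AW-member k v) mem)

BW-descent : ∀ k (w : Word (suc (suc m))) → T (inW (suc (suc m)) k w ∧ not (firstLtLast w)) → Descent w
BW-descent k w mem =
  let (w-inj , _) , ¬asc = Equivalence.to (BW-member k w) mem
  in descent-of-non-ascent w w-inj ¬asc

count-complement : ∀ {a b t k} → a + b ≡ t → b ≡ k → a ≡ t ∸ k
count-complement {a} {b} refl refl = sym (m+n∸n≡m a b)

Φ-into : ∀ k (v : Word (suc (suc m))) → T (inW _ k v ∧ firstLtLast v) →
         T (inW _ (suc (suc m) + 1 ∸ k) (Φ v) ∧ not (firstLtLast (Φ v)))
Φ-into {m} k v mem =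
  let (v-inj , wex≡k) , asc = Equivalence.to (AW-member k v) mem
  in Equivalence.from (BW-member (suc (suc m) + 1 ∸ k) (Φ v))
       ((transform-permutation (lookup v top ≟ top) v v-inj
        , count-complement (Φ-wex v v-inj asc) wex≡k)
        , Φ-descent v asc)

Ψ-into : ∀ {k} → k ≤ suc (suc m) + 1 → ∀ (w : Word (suc (suc m))) →
         T (inW _ (suc (suc m) + 1 ∸ k) w ∧ not (firstLtLast w)) →
         T (inW _ k (Ψ w) ∧ firstLtLast (Ψ w))
Ψ-into {m} {k} k≤ w mem =
  let (w-inj , wex≡) , _ = Equivalence.to (BW-member (suc (suc m) + 1 ∸ k) w) mem
      desc = BW-descent (suc (suc m) + 1 ∸ k) w mem
  in Equivalence.from (AW-member k (Ψ w))
       ((transform-permutation (lookup w zero ≟ top) w w-inj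
        , trans (count-complement (Ψ-wex w w-inj desc) wex≡) (m∸[m∸n]≡n k≤))
        , Ψ-ascent w desc)

restrict-↔ : ∀ {p q : A → Bool} (f g : A → A) →
             (∀ x → T (p x) → T (q (f x))) → (∀ y → T (q y) → T (p (g y))) →
             (∀ x → T (p x) → g (f x) ≡ x) → (∀ y → T (q y) → f (g y) ≡ y) →
             Σ A (λ x → T (p x)) ↔ Σ A (λ y → T (q y))
restrict-↔ f g f-into g-into g∘f f∘g = mk↔ₛ′
  (λ (x , px) → f x , f-into x px) (λ (y , qy) → g y , g-into y qy)
  (λ (y , qy) → Σ-≡,≡→≡ (f∘g y qy , T-irrelevant _ _))
  (λ (x , px) → Σ-≡,≡→≡ (g∘f x px , T-irrelevant _ _))

theorem3p3 : (n k : ℕ) → 2 ≤ n → 1 ≤ k → k ≤ n → AW n k ↔ BW n (n + 1 ∸ k)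
theorem3p3 (suc (suc m)) k (s≤s (s≤s z≤n)) _ k≤n =
  restrict-↔ Φ Ψ (Φ-into k) (Ψ-into (≤-trans k≤n (m≤m+n _ 1)))
    (λ v mem → Ψ∘Φ v (AW-ascent k v mem))
    (λ w mem → Φ∘Ψ w (BW-descent (suc (suc m) + 1 ∸ k) w mem))
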